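{- Let $\mathcal{U}\neq\{\Omega_n,\emptyset\}$ be a family of subsets of $\Omega_n=\{1,\dots,n\}$ closed under pairwise union, containing $\Omega_n$ and $\emptyset$, with non-empty members $A_1<A_2<\dots<A_k$. Suppose $\mathcal{U}$ is not canonical, that $\{A_1,\dots,A_{k-1},\emptyset\}$ is canonical, and that $|A_k|=m$. Then every permutation $\Pi$ of $\Omega_n$ with $s(\Pi(\mathcal{U}))<s(\mathcal{U})$ (lexicographically) satisfies $\Pi(\mathcal{U}_{m+1})=\mathcal{U}_{m+1}$, where $\mathcal{U}_{m+1}$ denotes the subfamily of all sets in $\mathcal{U}$ of size at least $m+1$.
   Context: For $A\subseteq\Omega_n$ let $b(A)=\sum_{i\in A}2^{i-1}$. Subsets of $\Omega_n$ are totally ordered by: $A>B$ if $|A|<|B|$, or $|A|=|B|$ and $b(A)>b(B)$ (so $\emptyset$ is the largest set and sets with more elements are smaller). For a family $\mathcal{U}$ of subsets of $\Omega_n$ containing $\emptyset$ whose non-empty members are $A_1<\dots<A_k$, define the string $s(\mathcal{U})=(b(A_1),\dots,b(A_k))$. For a permutation $\Pi$ of $\Omega_n$, $\Pi(\mathcal{U})=\{\Pi(A):A\in\mathcal{U}\}$. The family $\mathcal{U}$ is canonical if $s(\mathcal{U})$ is lexicographically smallest among all $s(\Pi(\mathcal{U}))$, $\Pi$ ranging over all permutations of $\Omega_n$. -}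

module Defs where

open import Data.Bool using (Bool; true; false; if_then_else_; _∧_; not)
open import Data.Nat using (ℕ; zero; suc; _+_; _*_; _^_; _<_; _>_; _≡ᵇ_; _≤ᵇ_)
open import Data.Nat.DivMod using (_/_; _%_)
open import Data.Fin using (Fin)
open import Data.Vec using (Vec; []; _∷_; tabulate; lookup)
open import Data.Fin.Subset using (Subset; ∣_∣)
open import Data.List using (List; map; concatMap; filterᵇ; upTo; downFrom)
open import Data.List.Relation.Binary.Lex.Strict using (Lex-<; Lex-≤)
open import Data.Fin.Permutation using (Permutation′; _⟨$⟩ʳ_; _⟨$⟩ˡ_; flip)
open import Data.Product using (_×_)
open import Data.Sum using (_⊎_)
open import Relation.Binary.PropositionalEquality using (_≡_)

-- Subsets of Ω_n = {1,…,n} are Subset n; index i : Fin n stands for element i+1.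

-- b(A) = Σ_{i∈A} 2^{i-1}  (element 1 has weight 1, element 2 weight 2, …)
b : ∀ {n} → Subset n → ℕ
b []       = 0
b (x ∷ xs) = (if x then 1 else 0) + 2 * b xs

_≺_ : ∀ {n} → Subset n → Subset n → Set
A ≺ B = (∣ A ∣ > ∣ B ∣) ⊎ ((∣ A ∣ ≡ ∣ B ∣) × (b A < b B))

eqᵇ : Bool → Bool → Bool
eqᵇ true  y = y
eqᵇ false y = not y

_==ˢ_ : ∀ {n} → Subset n → Subset n → Bool
[]       ==ˢ []       = true
(x ∷ xs) ==ˢ (y ∷ ys) = eqᵇ x y ∧ (xs ==ˢ ys)

Fam : ℕ → Set
Fam n = Subset n → Bool

decode : (n : ℕ) → ℕ → Subset n
decode zero    v = []
decode (suc n) v = (v % 2 ≡ᵇ 1) ∷ decode n (v / 2)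

-- the non-empty members of U listed in increasing ≺-order:
-- sizes n, n-1, …, 1, and within each size by increasing b-value
sortedMembers : ∀ {n} → Fam n → List (Subset n)
sortedMembers {n} U =
  concatMap (λ k → filterᵇ (λ A → U A ∧ (∣ A ∣ ≡ᵇ k)) (map (decode n) (upTo (2 ^ n))))
            (map suc (downFrom n))

s : ∀ {n} → Fam n → List ℕ
s U = map b (sortedMembers U)

_<ˡᵉˣ_ : List ℕ → List ℕ → Set
_<ˡᵉˣ_ = Lex-< _≡_ _<_

_≤ˡᵉˣ_ : List ℕ → List ℕ → Set
_≤ˡᵉˣ_ = Lex-≤ _≡_ _<_

-- Π(A) = { Π(i) : i ∈ A }, i.e. j ∈ Π(A) iff Π⁻¹(j) ∈ A
imageSet : ∀ {n} → Permutation′ n → Subset n → Subset n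
imageSet π A = tabulate (λ j → lookup A (π ⟨$⟩ˡ j))

-- Π(U) = { Π(A) : A ∈ U }, i.e. B ∈ Π(U) iff Π⁻¹(B) ∈ U
imageFam : ∀ {n} → Permutation′ n → Fam n → Fam n
imageFam π U B = U (imageSet (flip π) B)

Canonical : ∀ {n} → Fam n → Set
Canonical {n} U = (π : Permutation′ n) → s U ≤ˡᵉˣ s (imageFam π U)

remove : ∀ {n} → Fam n → Subset n → Fam n
remove U A B = U B ∧ not (B ==ˢ A)

atLeast : ∀ {n} → ℕ → Fam n → Fam n
atLeast m U B = U B ∧ (suc m ≤ᵇ ∣ B ∣)

UnionClosed : ∀ {n} → Fam n → Set
UnionClosed U = ∀ A B → U A ≡ true → U B ≡ true → U (A Data.Fin.Subset.∪ B) ≡ true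

-- Removing A_k, a set of size m, does not change the members of size above m, and these form
-- the common initial segment of the strings s(U), s(Π(U)), s(U ∖ {A_k}) and s(Π(U ∖ {A_k})),
-- of the same length for U and Π(U) because Π preserves sizes.  Canonicity of U ∖ {A_k} makes
-- this segment of s(U) lexicographically at most that of s(Π(U)), while s(Π(U)) < s(U) forbids
-- it from being larger; so the two segments coincide, and with them the members of size above m.
module Submission where

open import Defs
open import Data.Bool using (Bool; true; false; T; if_then_else_; _∧_; _∨_)
open import Data.Bool.Properties using (T?; ∧-zeroʳ; ∧-identityʳ)
open import Data.Nat using (ℕ; zero; suc; _+_; _*_; _^_; _∸_; _≤_; _<_; z≤n; s≤s; _≡ᵇ_; _≤ᵇ_)
open import Data.Nat.Properties
open import Data.Nat.DivMod
  using (_/_; _%_; m%n<n; m*n/n≡m; m*n%n≡0; +-distrib-/; [m+kn]%n≡m%n; m<n*o⇒m/o<n; m≡m%n+[m/n]*n)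
open import Data.Fin using (Fin)
import Data.Fin as Fin
open import Data.Fin.Subset using (Subset; ⊤; ⊥; ∣_∣)
open import Data.Fin.Subset.Properties using (∣p∣≤n)
open import Data.Fin.Permutation using (Permutation′; _⟨$⟩ʳ_; _⟨$⟩ˡ_; flip; inverseˡ; inverseʳ)
open import Data.Vec using ([]; _∷_; lookup)
open import Data.Vec.Properties using (lookup∘tabulate; tabulate∘lookup; tabulate-cong)
open import Data.List using (List; []; _∷_; _++_; map; length; filterᵇ; concatMap; upTo; downFrom; tabulate; allFin)
open import Data.List.Properties using (length-map; length-++; map-++; map-∘; map-id-local; concatMap-++; map-injective)
open import Data.List.Membership.Propositional using (_∈_)
open import Data.List.Membership.Propositional.Properties
  using (∈-map⁺; ∈-map⁻; ∈-filter⁺; ∈-filter⁻; ∈-upTo⁺; ∈-upTo⁻; ∈-allFin; ∈-concatMap⁺; ∈-concatMap⁻)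
open import Data.List.Membership.Propositional.Properties.WithK using (unique∧set⇒bag)
open import Data.List.Relation.Binary.BagAndSetEquality using (∼bag⇒↭)
open import Data.List.Relation.Binary.Lex.Strict using (Lex-<; Lex-≤; this; next)
open import Data.List.Relation.Binary.Permutation.Propositional.Properties using (↭-length)
import Data.List.Relation.Unary.All as All
open import Data.List.Relation.Unary.Any using (here; there; satisfied)
import Data.List.Relation.Unary.Any as Any
open import Data.List.Relation.Unary.Unique.Propositional using (Unique)
import Data.List.Relation.Unary.Unique.Propositional.Properties as Unique
open import Data.Product using (_,_; proj₂)
open import Data.Sum using (_⊎_)
open import Function using (_∘_; _∘′_; id; mk⇔)
open import Relation.Binary using (Rel; Asymmetric)
open import Relation.Binary.PropositionalEquality
open import Relation.Nullary using (¬_; contradiction; yes; no)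

filterᵇ-cong : ∀ {a} {X : Set a} {p q : X → Bool} → (∀ x → p x ≡ q x) → ∀ xs → filterᵇ p xs ≡ filterᵇ q xs
filterᵇ-cong p≗q []       = refl
filterᵇ-cong {p = p} {q} p≗q (x ∷ xs) with p x | q x | p≗q x
... | true  | true  | refl = cong (x ∷_) (filterᵇ-cong p≗q xs)
... | false | false | refl = filterᵇ-cong p≗q xs

length-filterᵇ-bijection : ∀ {a} {X : Set a} (f g : X → X) →
  (∀ x → g (f x) ≡ x) → (∀ x → f (g x) ≡ x) →
  (P Q : X → Bool) → (∀ x → Q x ≡ P (f x)) →
  {e : List X} → Unique e → (∀ x → x ∈ e) →
  length (filterᵇ Q e) ≡ length (filterᵇ P e)
length-filterᵇ-bijection f g gf fg P Q Q≡P∘f {e} e! e-complete =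
  trans (sym (length-map f (filterᵇ Q e)))
        (↭-length (∼bag⇒↭ (unique∧set⇒bag image! filterᵇP! (mk⇔ to from))))
  where
  f-injective : ∀ {x y} → f x ≡ f y → x ≡ y
  f-injective {x} {y} fx≡fy = trans (sym (gf x)) (trans (cong g fx≡fy) (gf y))
  image! : Unique (map f (filterᵇ Q e))
  image! = Unique.map⁺ f-injective (Unique.filter⁺ (T? ∘ Q) e!)
  filterᵇP! : Unique (filterᵇ P e)
  filterᵇP! = Unique.filter⁺ (T? ∘ P) e!
  to : ∀ {y} → y ∈ map f (filterᵇ Q e) → y ∈ filterᵇ P e
  to y∈ with x , x∈ , refl ← ∈-map⁻ f y∈ =
    ∈-filter⁺ (T? ∘ P) (e-complete (f x)) (subst T (Q≡P∘f x) (proj₂ (∈-filter⁻ (T? ∘ Q) {xs = e} x∈)))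
  from : ∀ {y} → y ∈ filterᵇ P e → y ∈ map f (filterᵇ Q e)
  from {y} y∈ = subst (_∈ map f (filterᵇ Q e)) (fg y)
    (∈-map⁺ f (∈-filter⁺ (T? ∘ Q) (e-complete (g y))
      (subst T (sym (trans (Q≡P∘f (g y)) (cong P (fg y)))) (proj₂ (∈-filter⁻ (T? ∘ P) {xs = e} y∈)))))

Lex-++-prefix-≡ : ∀ {a ℓ} {A : Set a} {_<_ : Rel A ℓ} → Asymmetric _<_ →
  ∀ {xs ys as bs cs ds : List A} → length xs ≡ length ys →
  Lex-≤ _≡_ _<_ (xs ++ as) (ys ++ bs) → Lex-< _≡_ _<_ (ys ++ cs) (xs ++ ds) → xs ≡ ys
Lex-++-prefix-≡ asym {[]}    {[]}    _   _             _             = refl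
Lex-++-prefix-≡ asym {_ ∷ _} {_ ∷ _} _   (this x<y)    (this y<x)    = contradiction y<x (asym x<y)
Lex-++-prefix-≡ asym {_ ∷ _} {_ ∷ _} _   (this x<x)    (next refl _) = contradiction x<x (asym x<x)
Lex-++-prefix-≡ asym {_ ∷ _} {_ ∷ _} _   (next refl _) (this x<x)    = contradiction x<x (asym x<x)
Lex-++-prefix-≡ asym {x ∷ _} {_ ∷ _} len (next refl xs≤ys) (next _ ys<xs) =
  cong (x ∷_) (Lex-++-prefix-≡ asym (suc-injective len) xs≤ys ys<xs)

bit : Bool → ℕ
bit x = if x then 1 else 0

bit≤1 : ∀ x → bit x ≤ 1
bit≤1 true  = ≤-refl
bit≤1 false = z≤n

b<2^n : ∀ {n} (A : Subset n) → b A < 2 ^ n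
b<2^n []              = s≤s z≤n
b<2^n {suc n} (x ∷ A) = begin-strict
  bit x + 2 * b A   ≤⟨ +-monoˡ-≤ (2 * b A) (bit≤1 x) ⟩
  1 + 2 * b A       <⟨ +-monoˡ-< (2 * b A) (n<1+n 1) ⟩
  2 + 2 * b A       ≡⟨ sym (*-suc 2 (b A)) ⟩
  2 * suc (b A)     ≤⟨ *-monoʳ-≤ 2 (b<2^n A) ⟩
  2 * 2 ^ n         ∎
  where open ≤-Reasoning

bit+2*k/2≡k : ∀ x k → (bit x + 2 * k) / 2 ≡ k
bit+2*k/2≡k x k rewrite *-comm 2 k with x
... | true  = trans (+-distrib-/ 1 (k * 2) (subst (λ t → 1 + t < 2) (sym (m*n%n≡0 k 2)) ≤-refl)) (m*n/n≡m k 2)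
... | false = m*n/n≡m k 2

bit+2*k%2≡1 : ∀ x k → ((bit x + 2 * k) % 2 ≡ᵇ 1) ≡ x
bit+2*k%2≡1 x k rewrite *-comm 2 k = trans (cong (_≡ᵇ 1) ([m+kn]%n≡m%n (bit x) k 2)) (bit%2≡1 x)
  where
  bit%2≡1 : ∀ x → (bit x % 2 ≡ᵇ 1) ≡ x
  bit%2≡1 true  = refl
  bit%2≡1 false = refl

bit[v%2≡1]≡v%2 : ∀ v → bit (v % 2 ≡ᵇ 1) ≡ v % 2
bit[v%2≡1]≡v%2 v with v % 2 | m%n<n v 2
... | 0           | _              = refl
... | 1           | _              = refl
... | suc (suc _) | s≤s (s≤s ())

decode-b : ∀ {n} (A : Subset n) → decode n (b A) ≡ A
decode-b []              = refl
decode-b {suc n} (x ∷ A) =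
  cong₂ _∷_ (bit+2*k%2≡1 x (b A)) (trans (cong (decode n) (bit+2*k/2≡k x (b A))) (decode-b A))

b-decode : ∀ n {v} → v < 2 ^ n → b (decode n v) ≡ v
b-decode zero    {zero}  _          = refl
b-decode zero    {suc _} (s≤s ())
b-decode (suc n) {v}     v<2^[1+n] = begin
  bit (v % 2 ≡ᵇ 1) + 2 * b (decode n (v / 2)) ≡⟨ cong₂ _+_ (bit[v%2≡1]≡v%2 v) (cong (2 *_) (b-decode n v/2<2^n)) ⟩
  v % 2 + 2 * (v / 2)                         ≡⟨ cong (v % 2 +_) (*-comm 2 (v / 2)) ⟩
  v % 2 + v / 2 * 2                           ≡⟨ sym (m≡m%n+[m/n]*n v 2) ⟩
  v                                           ∎
  where
  open ≡-Reasoning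
  v/2<2^n : v / 2 < 2 ^ n
  v/2<2^n = m<n*o⇒m/o<n (subst (v <_) (*-comm 2 (2 ^ n)) v<2^[1+n])

b-injective : ∀ {n} {A B : Subset n} → b A ≡ b B → A ≡ B
b-injective {n} {A} {B} bA≡bB = trans (sym (decode-b A)) (trans (cong (decode n) bA≡bB) (decode-b B))

subsets : ∀ n → List (Subset n)
subsets n = map (decode n) (upTo (2 ^ n))

∈-subsets : ∀ {n} (A : Subset n) → A ∈ subsets n
∈-subsets {n} A = subst (_∈ subsets n) (decode-b A) (∈-map⁺ (decode n) (∈-upTo⁺ (b<2^n A)))

subsets-unique : ∀ n → Unique (subsets n)
subsets-unique n = Unique.map⁻ (subst Unique (sym map-b-subsets) (Unique.upTo⁺ (2 ^ n)))
  where
  map-b-subsets : map b (subsets n) ≡ upTo (2 ^ n)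
  map-b-subsets = trans (sym (map-∘ (upTo (2 ^ n))))
                        (map-id-local (All.tabulate (λ v∈ → b-decode n (∈-upTo⁻ v∈))))

imageSet-flip-cancelˡ : ∀ {n} (ρ : Permutation′ n) A → imageSet (flip ρ) (imageSet ρ A) ≡ A
imageSet-flip-cancelˡ ρ A = trans
  (tabulate-cong (λ j → trans (lookup∘tabulate _ (flip ρ ⟨$⟩ˡ j)) (cong (lookup A) (inverseˡ ρ))))
  (tabulate∘lookup A)

imageSet-flip-cancelʳ : ∀ {n} (ρ : Permutation′ n) A → imageSet ρ (imageSet (flip ρ) A) ≡ A
imageSet-flip-cancelʳ ρ = imageSet-flip-cancelˡ (flip ρ)

∣p∣≡length-filterᵇ : ∀ {n} (p : Subset n) {X : Set} (f : Fin n → X) (P : X → Bool) →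
  (∀ i → P (f i) ≡ lookup p i) → ∣ p ∣ ≡ length (filterᵇ P (tabulate f))
∣p∣≡length-filterᵇ []      f P P∘f≡p = refl
∣p∣≡length-filterᵇ (x ∷ p) f P P∘f≡p with P (f Fin.zero) | P∘f≡p Fin.zero
... | true  | refl = cong suc (∣p∣≡length-filterᵇ p (f ∘′ Fin.suc) P (P∘f≡p ∘ Fin.suc))
... | false | refl = ∣p∣≡length-filterᵇ p (f ∘′ Fin.suc) P (P∘f≡p ∘ Fin.suc)

∣imageSet∣ : ∀ {n} (ρ : Permutation′ n) (p : Subset n) → ∣ imageSet ρ p ∣ ≡ ∣ p ∣
∣imageSet∣ {n} ρ p = begin
  ∣ imageSet ρ p ∣                                    ≡⟨ ∣p∣≡length-filterᵇ (imageSet ρ p) id _ (λ _ → refl) ⟩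
  length (filterᵇ (lookup (imageSet ρ p)) (allFin n)) ≡⟨ length-filterᵇ-bijection (ρ ⟨$⟩ˡ_) (ρ ⟨$⟩ʳ_)
                                                           (λ _ → inverseʳ ρ) (λ _ → inverseˡ ρ) (lookup p) _
                                                           (lookup∘tabulate _) (Unique.allFin⁺ n) ∈-allFin ⟩
  length (filterᵇ (lookup p) (allFin n))              ≡⟨ sym (∣p∣≡length-filterᵇ p id _ (λ _ → refl)) ⟩
  ∣ p ∣                                               ∎
  where open ≡-Reasoning

imageFam-atLeast : ∀ {n} m (π : Permutation′ n) (V : Fam n) B →
  imageFam π (atLeast m V) B ≡ atLeast m (imageFam π V) B
imageFam-atLeast m π V B = cong (λ k → imageFam π V B ∧ (suc m ≤ᵇ k)) (∣imageSet∣ (flip π) B)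

-- The k-th block of sortedMembers V, verbatim, so that s V unfolds to concatMap (layer V) over sizes.
layer : ∀ {n} → Fam n → ℕ → List (Subset n)
layer {n} V k = filterᵇ (λ A → V A ∧ (∣ A ∣ ≡ᵇ k)) (subsets n)

sizesAbove : ℕ → ℕ → List ℕ
sizesAbove m zero    = []
sizesAbove m (suc d) = suc (d + m) ∷ sizesAbove m d

upper : ∀ {n} → ℕ → Fam n → List (Subset n)
upper {n} m V = concatMap (layer V) (sizesAbove m (n ∸ m))

lower : ∀ {n} → ℕ → Fam n → List (Subset n)
lower m V = concatMap (layer V) (map suc (downFrom m))

sizes-++ : ∀ m d → map suc (downFrom (d + m)) ≡ sizesAbove m d ++ map suc (downFrom m)
sizes-++ m zero    = refl
sizes-++ m (suc d) = cong (suc (d + m) ∷_) (sizes-++ m d)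

s-upper-lower : ∀ {n m} → m ≤ n → (V : Fam n) → s V ≡ map b (upper m V) ++ map b (lower m V)
s-upper-lower {n} {m} m≤n V = begin
  map b (concatMap (layer V) (map suc (downFrom n)))                          ≡⟨ cong string (sym (m∸n+n≡m m≤n)) ⟩
  map b (concatMap (layer V) (map suc (downFrom (n ∸ m + m))))                ≡⟨ cong (map b ∘ concatMap (layer V)) (sizes-++ m (n ∸ m)) ⟩
  map b (concatMap (layer V) (sizesAbove m (n ∸ m) ++ map suc (downFrom m))) ≡⟨ cong (map b) (concatMap-++ (layer V) (sizesAbove m (n ∸ m)) _) ⟩
  map b (upper m V ++ lower m V)                                              ≡⟨ map-++ b (upper m V) (lower m V) ⟩
  map b (upper m V) ++ map b (lower m V)                                      ∎
  where
  open ≡-Reasoning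
  string : ℕ → List ℕ
  string k = map b (concatMap (layer V) (map suc (downFrom k)))

layer-cong : ∀ {n} {V W : Fam n} k → (∀ A → ∣ A ∣ ≡ k → V A ≡ W A) → layer V k ≡ layer W k
layer-cong {n} {V} {W} k V≡W = filterᵇ-cong agree (subsets n)
  where
  agree : ∀ A → (V A ∧ (∣ A ∣ ≡ᵇ k)) ≡ (W A ∧ (∣ A ∣ ≡ᵇ k))
  agree A with ∣ A ∣ ≡ᵇ k in eq
  ... | true  = cong (_∧ true) (V≡W A (≡ᵇ⇒≡ ∣ A ∣ k (subst T (sym eq) _)))
  ... | false = trans (∧-zeroʳ (V A)) (sym (∧-zeroʳ (W A)))

upper-cong : ∀ {n} m {V W : Fam n} → (∀ A → m < ∣ A ∣ → V A ≡ W A) → upper m V ≡ upper m W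
upper-cong {n} m {V} {W} V≡W = go (n ∸ m)
  where
  go : ∀ d → concatMap (layer V) (sizesAbove m d) ≡ concatMap (layer W) (sizesAbove m d)
  go zero    = refl
  go (suc d) = cong₂ _++_ (layer-cong _ (λ A ∣A∣≡ → V≡W A (subst (m <_) (sym ∣A∣≡) (s≤s (m≤n+m m d))))) (go d)

length-layer-imageFam : ∀ {n} (π : Permutation′ n) (V : Fam n) k →
  length (layer (imageFam π V) k) ≡ length (layer V k)
length-layer-imageFam {n} π V k =
  length-filterᵇ-bijection (imageSet (flip π)) (imageSet π) (imageSet-flip-cancelʳ π) (imageSet-flip-cancelˡ π)
    _ _ (λ A → cong (λ j → V (imageSet (flip π) A) ∧ (j ≡ᵇ k)) (sym (∣imageSet∣ (flip π) A)))
    (subsets-unique n) ∈-subsets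

length-upper-imageFam : ∀ {n} m (π : Permutation′ n) (V : Fam n) →
  length (upper m (imageFam π V)) ≡ length (upper m V)
length-upper-imageFam {n} m π V = go (n ∸ m)
  where
  go : ∀ d → length (concatMap (layer (imageFam π V)) (sizesAbove m d)) ≡ length (concatMap (layer V) (sizesAbove m d))
  go zero    = refl
  go (suc d) = begin
    length (layer (imageFam π V) k ++ concatMap (layer (imageFam π V)) (sizesAbove m d))
      ≡⟨ length-++ (layer (imageFam π V) k) ⟩
    length (layer (imageFam π V) k) + length (concatMap (layer (imageFam π V)) (sizesAbove m d))
      ≡⟨ cong₂ _+_ (length-layer-imageFam π V k) (go d) ⟩
    length (layer V k) + length (concatMap (layer V) (sizesAbove m d))
      ≡⟨ length-++ (layer V k) ⟨
    length (layer V k ++ concatMap (layer V) (sizesAbove m d)) ∎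
    where
    open ≡-Reasoning
    k : ℕ
    k = suc (d + m)

∈-sizesAbove : ∀ {m k} d → m < k → k ≤ d + m → k ∈ sizesAbove m d
∈-sizesAbove     zero    m<k k≤m   = contradiction k≤m (<⇒≱ m<k)
∈-sizesAbove {m} {k} (suc d) m<k k≤1+d+m with k ≟ suc (d + m)
... | yes refl = here refl
... | no  k≢   = there (∈-sizesAbove d m<k (≤-pred (≤∧≢⇒< k≤1+d+m k≢)))

∈-upper⁻ : ∀ {n} m (V : Fam n) {A} → A ∈ upper m V → V A ≡ true
∈-upper⁻ {n} m V {A} A∈ with k , A∈layer ← satisfied (∈-concatMap⁻ (layer V) {xs = sizesAbove m (n ∸ m)} A∈) =
  ∧-true (proj₂ (∈-filter⁻ (T? ∘ λ B → V B ∧ (∣ B ∣ ≡ᵇ k)) {xs = subsets n} A∈layer))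
  where
  ∧-true : ∀ {x y} → T (x ∧ y) → x ≡ true
  ∧-true {true} _ = refl

∈-upper⁺ : ∀ {n} m (V : Fam n) {A} → V A ≡ true → m < ∣ A ∣ → A ∈ upper m V
∈-upper⁺ {n} m V {A} VA m<∣A∣ = ∈-concatMap⁺ (layer V) {xs = sizesAbove m (n ∸ m)}
  (Any.map (λ { refl → A∈layer }) (∈-sizesAbove (n ∸ m) m<∣A∣ ∣A∣≤n∸m+m))
  where
  ∣A∣≤n∸m+m : ∣ A ∣ ≤ n ∸ m + m
  ∣A∣≤n∸m+m = subst (∣ A ∣ ≤_) (sym (m∸n+n≡m (≤-trans (<⇒≤ m<∣A∣) (∣p∣≤n A)))) (∣p∣≤n A)
  A∈layer : A ∈ layer V ∣ A ∣
  A∈layer = ∈-filter⁺ _ (∈-subsets A) (subst (λ x → T (x ∧ (∣ A ∣ ≡ᵇ ∣ A ∣))) (sym VA) (≡⇒≡ᵇ ∣ A ∣ ∣ A ∣ refl))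

upper-≡⇒atLeast-≡ : ∀ {n} m {V W : Fam n} → upper m V ≡ upper m W → ∀ B → atLeast m V B ≡ atLeast m W B
upper-≡⇒atLeast-≡ m {V} {W} V≡W B with suc m ≤ᵇ ∣ B ∣ in eq
... | false = trans (∧-zeroʳ (V B)) (sym (∧-zeroʳ (W B)))
... | true  = cong (_∧ true) (bool-ext (λ VB → ∈-upper⁻ m W (subst (B ∈_) V≡W (∈-upper⁺ m V VB m<∣B∣)))
                                       (λ WB → ∈-upper⁻ m V (subst (B ∈_) (sym V≡W) (∈-upper⁺ m W WB m<∣B∣))))
  where
  m<∣B∣ : m < ∣ B ∣
  m<∣B∣ = ≤ᵇ⇒≤ (suc m) ∣ B ∣ (subst T (sym eq) _)
  bool-ext : ∀ {x y : Bool} → (x ≡ true → y ≡ true) → (y ≡ true → x ≡ true) → x ≡ y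
  bool-ext {false} {false} _   _   = refl
  bool-ext {false} {true}  _   y⇒x = y⇒x refl
  bool-ext {true}          x⇒y _   = sym (x⇒y refl)

==ˢ⇒≡ : ∀ {n} (A B : Subset n) → (A ==ˢ B) ≡ true → A ≡ B
==ˢ⇒≡ []          []          _  = refl
==ˢ⇒≡ (true ∷ A)  (true ∷ B)  eq = cong (true ∷_) (==ˢ⇒≡ A B eq)
==ˢ⇒≡ (false ∷ A) (false ∷ B) eq = cong (false ∷_) (==ˢ⇒≡ A B eq)

remove-above : ∀ {n} (U : Fam n) {A B} → ∣ B ∣ < ∣ A ∣ → remove U B A ≡ U A
remove-above U {A} {B} ∣B∣<∣A∣ with A ==ˢ B in eq
... | true  = contradiction (cong ∣_∣ (==ˢ⇒≡ A B eq)) (>⇒≢ ∣B∣<∣A∣)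
... | false = ∧-identityʳ (U A)

upper-imageFam-≡ : ∀ {n} m → m ≤ n → (U V : Fam n) → (∀ A → m < ∣ A ∣ → V A ≡ U A) → Canonical V →
  (π : Permutation′ n) → s (imageFam π U) <ˡᵉˣ s U → upper m U ≡ upper m (imageFam π U)
upper-imageFam-≡ m m≤n U V V≡U canV π πU<U = map-injective b-injective
  (Lex-++-prefix-≡ <-asym {as = map b (lower m V)} {cs = map b (lower m πU)}
    (trans (length-map b (upper m U)) (sym (trans (length-map b (upper m πU)) (length-upper-imageFam m π U))))
    (subst₂ (Lex-≤ _≡_ _<_) (split V U (upper-cong m V≡U)) (split (imageFam π V) πU (upper-cong m πV≡πU)) (canV π))
    (subst₂ (Lex-< _≡_ _<_) (split πU πU refl) (split U U refl) πU<U))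
  where
  πU : Fam _
  πU = imageFam π U
  πV≡πU : ∀ A → m < ∣ A ∣ → imageFam π V A ≡ πU A
  πV≡πU A m<∣A∣ = V≡U (imageSet (flip π) A) (subst (m <_) (sym (∣imageSet∣ (flip π) A)) m<∣A∣)
  split : ∀ W W′ → upper m W ≡ upper m W′ → s W ≡ map b (upper m W′) ++ map b (lower m W)
  split W W′ W≡W′ = trans (s-upper-lower m≤n W) (cong (λ xs → map b xs ++ map b (lower m W)) W≡W′)

lemma3 : (n : ℕ) (U : Fam n) (Ak : Subset n) (m : ℕ) →
    ¬ (∀ B → U B ≡ ((B ==ˢ ⊤) ∨ (B ==ˢ ⊥))) →
    UnionClosed U →
    U ⊤ ≡ true →
    U ⊥ ≡ true →
    U Ak ≡ true →
    Ak ≢ ⊥ →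
    (∀ B → U B ≡ true → B ≢ ⊥ → (B ≺ Ak) ⊎ (B ≡ Ak)) →
    ¬ Canonical U →
    Canonical (remove U Ak) →
    ∣ Ak ∣ ≡ m →
    (π : Permutation′ n) →
    s (imageFam π U) <ˡᵉˣ s U →
    ∀ B → imageFam π (atLeast m U) B ≡ atLeast m U B
lemma3 n U Ak m _ _ _ _ _ _ _ _ canonical-U∖Ak refl π πU<U B = begin
  imageFam π (atLeast m U) B ≡⟨ imageFam-atLeast m π U B ⟩
  atLeast m (imageFam π U) B ≡⟨ upper-≡⇒atLeast-≡ m (sym upper-agree) B ⟩
  atLeast m U B              ∎
  where
  open ≡-Reasoning
  upper-agree : upper m U ≡ upper m (imageFam π U)
  upper-agree = upper-imageFam-≡ m (∣p∣≤n Ak) U (remove U Ak) (λ A → remove-above U) canonical-U∖Ak π πU<U
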